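{- For every $n\ge 1$, \[\sum_{\sigma\in B_n} sign(\sigma)\, q^{\text{flag-major}_N(\sigma)}=(q;-1)_n\,[n]_{\pm q^2}!.\]
   Context: $B_n$ is the group of bijections $\sigma$ of $[-n,n]\setminus\{0\}$ with $\sigma(-a)=-\sigma(a)$, written $\sigma=[\sigma(1),\dots,\sigma(n)]$. $N$ is the natural order $-n<-(n-1)<\dots<-1<1<\dots<n$. $Des_N(\sigma)=\{1\le i\le n-1:\sigma(i)>\sigma(i+1)\}$ (w.r.t. $N$), $maj_N(\sigma)=\sum_{i\in Des_N(\sigma)}i$, $neg(\sigma)=|\{i:\sigma(i)<0\}|$, $\text{flag-major}_N(\sigma)=2maj_N(\sigma)+neg(\sigma)$. The length $\ell(\sigma)$ is the Coxeter length with respect to the generators $s_0=[-1,2,\dots,n]$, $s_i=[1,\dots,i-1,i+1,i,i+2,\dots,n]$ ($1\le i\le n-1$); equivalently $\ell(\sigma)=inv_N(\sigma)-\sum_{i:\sigma(i)<0}\sigma(i)$ with $inv_N(\sigma)=|\{i<j:\sigma(i)>\sigma(j)\}|$. $sign(\sigma)=(-1)^{\ell(\sigma)}$. Notation: $[k]_x=\frac{1-x^k}{1-x}$, $[n]_{\pm x}!=[1]_x[2]_{ -x}[3]_x\cdots[n]_{(-1)^{n-1}x}$, and $(a;x)_n=\prod_{k=0}^{n-1}(1-ax^k)$ (equal to $1$ for $n=0$). -}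

module Defs where

open import Level using (Level)
open import Data.Bool using (Bool; true; false; if_then_else_; _∧_; not)
open import Data.Nat as ℕ using (ℕ; zero; suc; _≡ᵇ_)
open import Data.Integer as ℤ using (ℤ; +_; -[1+_]; ∣_∣)
open import Data.List using (List; []; _∷_; map; _++_; upTo; concatMap; filter; foldr; length)
open import Relation.Nullary using (does)
open import Algebra.Bundles using (CommutativeRing)

-- Signed permutations of B_n, written in window notation
-- σ = [σ(1), …, σ(n)] as a list of nonzero integers.

alphabet : ℕ → List ℤ
alphabet n = map (λ k → + suc k) (upTo n) ++ map (λ k → -[1+ k ]) (upTo n)

words : ℕ → List ℤ → List (List ℤ)
words zero    A = [] ∷ []
words (suc m) A = concatMap (λ a → map (a ∷_) (words m A)) A

distinct : List ℕ → Bool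
distinct []       = true
distinct (x ∷ xs) = not (foldr (λ y b → (x ≡ᵇ y) Data.Bool.∨ b) false xs) ∧ distinct xs

-- A word of length n over [-n,n]\{0} is the window of an element of B_n
-- iff the absolute values |σ(1)|,…,|σ(n)| are pairwise distinct.
isSignedPerm : List ℤ → Bool
isSignedPerm w = distinct (map ∣_∣ w)

B : ℕ → List (List ℤ)
B n = filter (λ w → Relation.Nullary.Decidable.Core.T? (isSignedPerm w)) (words n (alphabet n))
  where import Relation.Nullary.Decidable.Core

-- Statistics (the natural order N on [-n,n]\{0} is the order of ℤ).

_>ᵇ_ : ℤ → ℤ → Bool
x >ᵇ y = does (y ℤ.<? x)

-- maj_N: sum of descent positions i (1 ≤ i ≤ n-1) with σ(i) > σ(i+1);
-- majFrom i w treats the head of w as position i.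
majFrom : ℕ → List ℤ → ℕ
majFrom i []           = 0
majFrom i (x ∷ [])     = 0
majFrom i (x ∷ y ∷ ys) = (if x >ᵇ y then i else 0) ℕ.+ majFrom (suc i) (y ∷ ys)

maj : List ℤ → ℕ
maj = majFrom 1

neg : List ℤ → ℕ
neg []             = 0
neg (+ _ ∷ xs)     = neg xs
neg (-[1+ _ ] ∷ xs) = suc (neg xs)

flagMajor : List ℤ → ℕ
flagMajor w = 2 ℕ.* maj w ℕ.+ neg w

countLess : ℤ → List ℤ → ℕ
countLess x []       = 0
countLess x (y ∷ ys) = (if x >ᵇ y then 1 else 0) ℕ.+ countLess x ys

inv : List ℤ → ℕ
inv []       = 0
inv (x ∷ xs) = countLess x xs ℕ.+ inv xs

negSum : List ℤ → ℕ
negSum []              = 0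
negSum (+ _ ∷ xs)      = negSum xs
negSum (-[1+ k ] ∷ xs) = suc k ℕ.+ negSum xs

-- Coxeter length ℓ(σ) = inv_N(σ) - Σ_{σ(i)<0} σ(i)
len : List ℤ → ℕ
len w = inv w ℕ.+ negSum w

-- Ring-valued expressions, for an arbitrary commutative ring R
-- (so the identity is an identity of polynomials in q).

module InRing {c ℓ : Level} (R : CommutativeRing c ℓ) where
  open CommutativeRing R

  pow : Carrier → ℕ → Carrier
  pow x zero    = 1#
  pow x (suc k) = x * pow x k

  sgnPow : ℕ → Carrier
  sgnPow zero    = 1#
  sgnPow (suc k) = - sgnPow k

  sign : List ℤ → Carrier
  sign w = sgnPow (len w)

  sumList : List Carrier → Carrier
  sumList = foldr _+_ 0#

  lhs : ℕ → Carrier → Carrier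
  lhs n q = sumList (map (λ w → sign w * pow q (flagMajor w)) (B n))

  qint : ℕ → Carrier → Carrier
  qint zero    x = 0#
  qint (suc k) x = 1# + x * qint k x

  prodUpTo : ℕ → (ℕ → Carrier) → Carrier
  prodUpTo zero    f = 1#
  prodUpTo (suc m) f = prodUpTo m f * f m

  qPoch : Carrier → Carrier → ℕ → Carrier
  qPoch a x m = prodUpTo m (λ k → 1# - a * pow x k)

  -- [m]_{±x}! = [1]_x [2]_{-x} [3]_x ⋯ [m]_{(-1)^{m-1} x}
  --           = ∏_{k=0}^{m-1} [k+1]_{(-1)^k x}
  signedFact : ℕ → Carrier → Carrier
  signedFact m x = prodUpTo m (λ k → qint (suc k) (sgnPow k * x))

  rhs : ℕ → Carrier → Carrier
  rhs n q = qPoch q (- 1#) n * signedFact n (pow q 2)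

-- The weight sign(σ) q^flag-major(σ) factors as (-1)^inv(σ) q^(2 maj σ) times the product of
-- (-1)^|σ(i)| q over the negative entries σ(i). The first factor only sees the relative order of
-- the window, the second only its set of entries, i.e. a choice of sign for each of 1, …, n.
-- Summing over the orderings of a fixed set thus gives the signed Mahonian sum
-- ∑_{π ∈ S_n} (-1)^inv(π) q^(2 maj π) = [n]_{±q²}! times the second factor, and summing that
-- factor over the sign choices gives ∏_k (1 + (-1)^(k+1) q) = (q;-1)_n.
-- The signed Mahonian identity is refined by the last letter b and proved by induction: for the
-- orderings w c of a set U of m+1 letters followed by b, appending b adds the rank of b in U to inv
-- and m+1 to maj exactly when c > b, so summing over the rank of c in U yields the rotated
-- geometric sum ((-1)^m q²)^rank(b) [m+1]_{(-1)^m q²}.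

{-# OPTIONS --safe #-}
module Submission where

open import Defs
open import Level using (Level)
open import Function using (_∘_; id)
open import Data.Bool using (Bool; true; false; if_then_else_; _∧_; _∨_; not; T; T?)
import Data.Bool.Properties as Boolₚ
open import Data.Empty using (⊥-elim)
open import Data.Nat as ℕ using (ℕ; zero; suc; _≡ᵇ_; _<ᵇ_; z≤n; s≤s; _≥_)
import Data.Nat.Properties as ℕₚ
import Data.Nat.Tactic.RingSolver as ℕ-Solver
open import Data.Integer as ℤ using (ℤ; -[1+_]; ∣_∣)
import Data.Integer.Properties as ℤₚ
open import Data.List as List using (List; []; _∷_; _∷ʳ_; map; _++_; length; foldr; filterᵇ; concatMap; filter; upTo)
import Data.List.Properties as Listₚ
open import Data.List.Membership.Propositional using (_∈_)
open import Data.List.Relation.Unary.Any using (here; there)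
open import Data.List.Relation.Unary.All as All using (All; []; _∷_)
import Data.List.Relation.Unary.All.Properties as Allₚ
open import Data.List.Relation.Unary.AllPairs using (AllPairs; []; _∷_)
import Data.List.Relation.Unary.AllPairs.Properties as AllPairsₚ
open import Data.List.Relation.Unary.Unique.Propositional using (Unique)
import Data.List.Relation.Unary.Unique.Propositional.Properties as Uniqueₚ
open import Data.Product using (∃; ∃₂; _×_; _,_)
open import Relation.Nullary using (¬_; does; yes; no)
open import Relation.Unary using (Decidable)
open import Algebra.Bundles using (CommutativeRing)
import Algebra.Properties.Group as GroupProperties
import Algebra.Properties.Ring as RingProperties
import Algebra.Solver.CommutativeMonoid as CommutativeMonoidSolver
open import Relation.Nullary.Decidable using (dec-true; dec-false)
open import Relation.Binary.Definitions using (tri<; tri≈; tri>)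
import Algebra.Properties.CommutativeSemigroup as CommutativeSemigroupProperties
open import Relation.Binary.PropositionalEquality
  using (_≡_; _≢_; refl; sym; trans; cong; cong₂; subst; module ≡-Reasoning)

private variable
  A B′ : Set

open CommutativeSemigroupProperties ℕₚ.+-commutativeSemigroup
  using () renaming (interchange to [m+n]+[o+p]≡[m+o]+[n+p]; x∙yz≈y∙xz to m+[n+o]≡n+[m+o])

≡ᵇ-refl : ∀ n → (n ≡ᵇ n) ≡ true
≡ᵇ-refl zero    = refl
≡ᵇ-refl (suc n) = ≡ᵇ-refl n

≡ᵇ-sym : ∀ m n → (m ≡ᵇ n) ≡ (n ≡ᵇ m)
≡ᵇ-sym zero    zero    = refl
≡ᵇ-sym zero    (suc n) = refl
≡ᵇ-sym (suc m) zero    = refl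
≡ᵇ-sym (suc m) (suc n) = ≡ᵇ-sym m n

≢⇒≡ᵇ-false : ∀ {m n} → m ≢ n → (m ≡ᵇ n) ≡ false
≢⇒≡ᵇ-false {m} {n} = dec-false (m ℕₚ.≟ n)

filterᵇ-filterᵇ : ∀ (p q : A → Bool) xs → filterᵇ q (filterᵇ p xs) ≡ filterᵇ (λ x → p x ∧ q x) xs
filterᵇ-filterᵇ p q []       = refl
filterᵇ-filterᵇ p q (x ∷ xs) with p x
... | false = filterᵇ-filterᵇ p q xs
... | true with q x
...   | true  = cong (x ∷_) (filterᵇ-filterᵇ p q xs)
...   | false = filterᵇ-filterᵇ p q xs

filterᵇ-cong : ∀ {p q : A → Bool} → (∀ x → p x ≡ q x) → ∀ xs → filterᵇ p xs ≡ filterᵇ q xs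
filterᵇ-cong p≗q []       = refl
filterᵇ-cong {p = p} {q} p≗q (x ∷ xs) rewrite p≗q x with q x
... | true  = cong (x ∷_) (filterᵇ-cong p≗q xs)
... | false = filterᵇ-cong p≗q xs

filterᵇ-map : ∀ (p : B′ → Bool) (f : A → B′) xs → filterᵇ p (map f xs) ≡ map f (filterᵇ (p ∘ f) xs)
filterᵇ-map p f []       = refl
filterᵇ-map p f (x ∷ xs) with p (f x)
... | true  = cong (f x ∷_) (filterᵇ-map p f xs)
... | false = filterᵇ-map p f xs

filterᵇ-true : ∀ (xs : List A) → filterᵇ (λ _ → true) xs ≡ xs
filterᵇ-true []       = refl
filterᵇ-true (x ∷ xs) = cong (x ∷_) (filterᵇ-true xs)

m*[1+m]-even : ∀ m → ∃ λ k → m ℕ.* suc m ≡ k ℕ.+ k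
m*[1+m]-even zero    = 0 , refl
m*[1+m]-even (suc m) with m*[1+m]-even m
... | k , m*[1+m]≡k+k = k ℕ.+ suc m , (begin
  suc m ℕ.* suc (suc m)                ≡⟨ expand m ⟩
  m ℕ.* suc m ℕ.+ (suc m ℕ.+ suc m)    ≡⟨ cong (ℕ._+ (suc m ℕ.+ suc m)) m*[1+m]≡k+k ⟩
  (k ℕ.+ k) ℕ.+ (suc m ℕ.+ suc m)      ≡⟨ [m+n]+[o+p]≡[m+o]+[n+p] k k (suc m) (suc m) ⟩
  (k ℕ.+ suc m) ℕ.+ (k ℕ.+ suc m)      ∎)
  where
  open ≡-Reasoning
  expand : ∀ m → suc m ℕ.* suc (suc m) ≡ m ℕ.* suc m ℕ.+ (suc m ℕ.+ suc m)
  expand = ℕ-Solver.solve-∀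

-- Lists of integers with distinct absolute values

infixl 6 _∖_

_∖_ : List ℤ → ℤ → List ℤ
U ∖ u = filterᵇ (λ v → not (∣ v ∣ ≡ᵇ ∣ u ∣)) U

DistinctAbs : List ℤ → Set
DistinctAbs = AllPairs (λ u v → ∣ u ∣ ≢ ∣ v ∣)

∖-fresh : ∀ v V → All (λ y → ∣ y ∣ ≢ ∣ v ∣) V → V ∖ v ≡ V
∖-fresh v []      []         = refl
∖-fresh v (y ∷ V) (y≢v ∷ V≢v) rewrite ≢⇒≡ᵇ-false y≢v = cong (y ∷_) (∖-fresh v V V≢v)

∷-∖-self : ∀ v V → All (λ y → ∣ y ∣ ≢ ∣ v ∣) V → (v ∷ V) ∖ v ≡ V
∷-∖-self v V V≢v rewrite ≡ᵇ-refl ∣ v ∣ = ∖-fresh v V V≢v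

∷-∖-other : ∀ {u v} V → ∣ u ∣ ≢ ∣ v ∣ → (u ∷ V) ∖ v ≡ u ∷ V ∖ v
∷-∖-other V u≢v rewrite ≢⇒≡ᵇ-false u≢v = refl

∖-split : ∀ {v V} → v ∈ V → DistinctAbs V →
          ∃₂ λ L₁ L₂ → V ≡ L₁ ++ v ∷ L₂ × V ∖ v ≡ L₁ ++ L₂
∖-split {v} {.v ∷ V} (here refl) (v≢V ∷ _) =
  [] , V , refl , ∷-∖-self v V (All.map (_∘ sym) v≢V)
∖-split {v} {u ∷ V} (there v∈V) (u≢V ∷ V!) with ∖-split v∈V V!
... | L₁ , L₂ , refl , V∖v≡ rewrite ≢⇒≡ᵇ-false (All.lookup u≢V v∈V) =
  u ∷ L₁ , L₂ , refl , cong (u ∷_) V∖v≡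

∖-comm : ∀ u v V → V ∖ u ∖ v ≡ V ∖ v ∖ u
∖-comm u v V = begin
  V ∖ u ∖ v                             ≡⟨ filterᵇ-filterᵇ _ _ V ⟩
  filterᵇ (λ w → keep u w ∧ keep v w) V ≡⟨ filterᵇ-cong (λ w → Boolₚ.∧-comm (keep u w) (keep v w)) V ⟩
  filterᵇ (λ w → keep v w ∧ keep u w) V ≡⟨ filterᵇ-filterᵇ _ _ V ⟨
  V ∖ v ∖ u                             ∎
  where
  open ≡-Reasoning
  keep : ℤ → ℤ → Bool
  keep u w = not (∣ w ∣ ≡ᵇ ∣ u ∣)

∖-avoids : ∀ v V → All (λ y → ∣ v ∣ ≢ ∣ y ∣) (V ∖ v)
∖-avoids v V = All.map (λ {y} → avoid {y}) (Allₚ.all-filter (λ y → T? (not (∣ y ∣ ≡ᵇ ∣ v ∣))) V)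
  where
  avoid : ∀ {y} → T (not (∣ y ∣ ≡ᵇ ∣ v ∣)) → ∣ v ∣ ≢ ∣ y ∣
  avoid {y} kept v≡y rewrite v≡y | ≡ᵇ-refl ∣ y ∣ = kept

distinctAbs-∖ : ∀ v {V} → DistinctAbs V → DistinctAbs (V ∖ v)
distinctAbs-∖ v = AllPairsₚ.filter⁺ _

distinctAbs-∷∖ : ∀ v {V} → DistinctAbs V → DistinctAbs (v ∷ V ∖ v)
distinctAbs-∷∖ v {V} V! = ∖-avoids v V ∷ distinctAbs-∖ v V!

length-∖ : ∀ {v V} → v ∈ V → DistinctAbs V → length V ≡ suc (length (V ∖ v))
length-∖ {v} v∈V V! with ∖-split v∈V V!
... | L₁ , L₂ , refl , V∖v≡ = begin
  length (L₁ ++ v ∷ L₂)           ≡⟨ Listₚ.length-++ L₁ ⟩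
  length L₁ ℕ.+ suc (length L₂)   ≡⟨ ℕₚ.+-suc (length L₁) (length L₂) ⟩
  suc (length L₁ ℕ.+ length L₂)   ≡⟨ cong suc (Listₚ.length-++ L₁) ⟨
  suc (length (L₁ ++ L₂))         ≡⟨ cong (suc ∘ length) V∖v≡ ⟨
  suc (length ((L₁ ++ v ∷ L₂) ∖ v)) ∎
  where open ≡-Reasoning

-- Ranks

infix 7 _when_

_when_ : ℕ → Bool → ℕ
n when b = if b then n else 0

when-≤ : ∀ n b → n when b ℕ.≤ n
when-≤ n true  = ℕₚ.≤-refl
when-≤ n false = z≤n

-- For L with distinct entries, the rank of b in L ∪ {b} counted from the top.
countAbove : ℤ → List ℤ → ℕ
countAbove b []      = 0
countAbove b (y ∷ L) = 1 when (y >ᵇ b) ℕ.+ countAbove b L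

countAbove-++ : ∀ b L₁ L₂ → countAbove b (L₁ ++ L₂) ≡ countAbove b L₁ ℕ.+ countAbove b L₂
countAbove-++ b []       L₂ = refl
countAbove-++ b (y ∷ L₁) L₂ rewrite countAbove-++ b L₁ L₂ =
  sym (ℕₚ.+-assoc (1 when (y >ᵇ b)) (countAbove b L₁) (countAbove b L₂))

countAbove-∖ : ∀ b {v V} → v ∈ V → DistinctAbs V →
               countAbove b V ≡ 1 when (v >ᵇ b) ℕ.+ countAbove b (V ∖ v)
countAbove-∖ b {v} v∈V V! with ∖-split v∈V V!
... | L₁ , L₂ , refl , V∖v≡ rewrite V∖v≡ | countAbove-++ b L₁ (v ∷ L₂) | countAbove-++ b L₁ L₂ =
  m+[n+o]≡n+[m+o] (countAbove b L₁) (1 when (v >ᵇ b)) (countAbove b L₂)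

countAbove-≤-length : ∀ b L → countAbove b L ℕ.≤ length L
countAbove-≤-length b []      = z≤n
countAbove-≤-length b (y ∷ L) = ℕₚ.+-mono-≤ (when-≤ 1 (y >ᵇ b)) (countAbove-≤-length b L)

>ᵇ-true : ∀ {x y} → y ℤ.< x → (x >ᵇ y) ≡ true
>ᵇ-true {x} {y} = dec-true (y ℤₚ.<? x)

>ᵇ-false : ∀ {x y} → ¬ (y ℤ.< x) → (x >ᵇ y) ≡ false
>ᵇ-false {x} {y} = dec-false (y ℤₚ.<? x)

>ᵇ-irrefl : ∀ x → (x >ᵇ x) ≡ false
>ᵇ-irrefl x = >ᵇ-false {x} {x} (ℤₚ.<-irrefl refl)

>ᵇ-asym : ∀ {x y} → x ≢ y → (x >ᵇ y) ≡ not (y >ᵇ x)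
>ᵇ-asym {x} {y} x≢y with ℤₚ.<-cmp x y
... | tri< x<y _ _ rewrite >ᵇ-false (ℤₚ.<-asym x<y) | >ᵇ-true x<y = refl
... | tri≈ _ x≡y _ = ⊥-elim (x≢y x≡y)
... | tri> _ _ y<x rewrite >ᵇ-true y<x | >ᵇ-false (ℤₚ.<-asym y<x) = refl

>ᵇ⇒> : ∀ {x y} → (x >ᵇ y) ≡ true → y ℤ.< x
>ᵇ⇒> {x} {y} x>y with y ℤₚ.<? x
... | yes y<x = y<x
>ᵇ⇒> () | no _

isAbove-antitone : ∀ {c u} → c ℤ.≤ u → ∀ y → 1 when (y >ᵇ u) ℕ.≤ 1 when (y >ᵇ c)
isAbove-antitone {u = u} c≤u y with y >ᵇ u in y>u
... | false = z≤n
... | true rewrite >ᵇ-true (ℤₚ.≤-<-trans c≤u (>ᵇ⇒> y>u)) = ℕₚ.≤-refl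

countAbove-antitone : ∀ {c u} → c ℤ.≤ u → ∀ L → countAbove u L ℕ.≤ countAbove c L
countAbove-antitone c≤u []      = z≤n
countAbove-antitone c≤u (y ∷ L) = ℕₚ.+-mono-≤ (isAbove-antitone c≤u y) (countAbove-antitone c≤u L)

countAbove-strict : ∀ {u c} → u ℤ.< c → ∀ {L} → c ∈ L → countAbove c L ℕ.< countAbove u L
countAbove-strict {u} {c} u<c {c ∷ L} (here refl) rewrite >ᵇ-irrefl c | >ᵇ-true u<c =
  s≤s (countAbove-antitone (ℤₚ.<⇒≤ u<c) L)
countAbove-strict {u} {c} u<c {y ∷ L} (there c∈L) =
  subst (ℕ._≤ countAbove u (y ∷ L)) (ℕₚ.+-suc (1 when (y >ᵇ c)) (countAbove c L))
    (ℕₚ.+-mono-≤ (isAbove-antitone (ℤₚ.<⇒≤ u<c) y) (countAbove-strict u<c c∈L))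

>ᵇ-countAbove : ∀ {u c L} → c ∈ L → u ≢ c → (u >ᵇ c) ≡ not (countAbove c L <ᵇ countAbove u L)
>ᵇ-countAbove {u} {c} {L} c∈L u≢c with ℤₚ.<-cmp u c
... | tri< u<c _ _ rewrite >ᵇ-false (ℤₚ.<-asym u<c)
                        | dec-true (countAbove c L ℕₚ.<? countAbove u L) (countAbove-strict u<c c∈L) = refl
... | tri≈ _ u≡c _ = ⊥-elim (u≢c u≡c)
... | tri> _ _ c<u rewrite >ᵇ-true c<u
                        | dec-false (countAbove c L ℕₚ.<? countAbove u L)
                            (ℕₚ.≤⇒≯ (countAbove-antitone (ℤₚ.<⇒≤ c<u) L)) = refl

∣u∣≢∣v∣⇒u≢v : ∀ {u v : ℤ} → ∣ u ∣ ≢ ∣ v ∣ → u ≢ v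
∣u∣≢∣v∣⇒u≢v ∣u∣≢∣v∣ refl = ∣u∣≢∣v∣ refl

countAbove-∖-self : ∀ {c U} → c ∈ U → DistinctAbs U → countAbove c (U ∖ c) ≡ countAbove c U
countAbove-∖-self {c} {U} c∈U U! =
  sym (trans (countAbove-∖ c c∈U U!) (cong (λ b → 1 when b ℕ.+ countAbove c (U ∖ c)) (>ᵇ-irrefl c)))

-- The statistics of a window extended on the right

countLess-∷ʳ : ∀ x w b → countLess x (w ∷ʳ b) ≡ countLess x w ℕ.+ 1 when (x >ᵇ b)
countLess-∷ʳ x []      b = ℕₚ.+-identityʳ _
countLess-∷ʳ x (y ∷ w) b rewrite countLess-∷ʳ x w b =
  sym (ℕₚ.+-assoc (1 when (x >ᵇ y)) (countLess x w) _)

inv-∷ʳ : ∀ w b → inv (w ∷ʳ b) ≡ inv w ℕ.+ countAbove b w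
inv-∷ʳ []      b = refl
inv-∷ʳ (x ∷ w) b rewrite countLess-∷ʳ x w b | inv-∷ʳ w b =
  [m+n]+[o+p]≡[m+o]+[n+p] (countLess x w) (1 when (x >ᵇ b)) (inv w) (countAbove b w)

negSum-++ : ∀ w v → negSum (w ++ v) ≡ negSum w ℕ.+ negSum v
negSum-++ []             v = refl
negSum-++ (ℤ.+ _ ∷ w)    v = negSum-++ w v
negSum-++ (-[1+ k ] ∷ w) v rewrite negSum-++ w v = sym (ℕₚ.+-assoc (suc k) (negSum w) _)

neg-++ : ∀ w v → neg (w ++ v) ≡ neg w ℕ.+ neg v
neg-++ []             v = refl
neg-++ (ℤ.+ _ ∷ w)    v = neg-++ w v
neg-++ (-[1+ _ ] ∷ w) v = cong suc (neg-++ w v)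

majFrom-∷ʳ : ∀ i w c b → majFrom i (w ∷ʳ c ∷ʳ b) ≡ majFrom i (w ∷ʳ c) ℕ.+ (i ℕ.+ length w) when (c >ᵇ b)
majFrom-∷ʳ i []          c b rewrite ℕₚ.+-identityʳ i = ℕₚ.+-identityʳ _
majFrom-∷ʳ i (x ∷ [])    c b rewrite majFrom-∷ʳ (suc i) [] c b | ℕₚ.+-suc i 0 =
  sym (ℕₚ.+-assoc (i when (x >ᵇ c)) _ _)
majFrom-∷ʳ i (x ∷ y ∷ w) c b rewrite majFrom-∷ʳ (suc i) (y ∷ w) c b | ℕₚ.+-suc i (suc (length w)) =
  sym (ℕₚ.+-assoc (i when (x >ᵇ y)) _ _)

len-∷ʳ : ∀ w b → len (w ∷ʳ b) ≡ len w ℕ.+ (countAbove b w ℕ.+ negSum (b ∷ []))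
len-∷ʳ w b rewrite inv-∷ʳ w b | negSum-++ w (b ∷ []) =
  [m+n]+[o+p]≡[m+o]+[n+p] (inv w) (countAbove b w) (negSum w) (negSum (b ∷ []))

flagMajor-∷ʳ : ∀ w c b → let J = suc (length w) when (c >ᵇ b) in
               flagMajor (w ∷ʳ c ∷ʳ b) ≡ flagMajor (w ∷ʳ c) ℕ.+ (2 ℕ.* J ℕ.+ neg (b ∷ []))
flagMajor-∷ʳ w c b rewrite majFrom-∷ʳ 1 w c b | neg-++ (w ∷ʳ c) (b ∷ [])
                         | ℕₚ.*-distribˡ-+ 2 (maj (w ∷ʳ c)) (suc (length w) when (c >ᵇ b)) =
  [m+n]+[o+p]≡[m+o]+[n+p] (2 ℕ.* maj (w ∷ʳ c)) _ (neg (w ∷ʳ c)) (neg (b ∷ []))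

-- When V has m entries with distinct absolute values, these are the orderings of V.
data Arrangement : ℕ → List ℤ → List ℤ → Set where
  []  : ∀ {V} → Arrangement 0 V []
  _∷_ : ∀ {m V v w} → v ∈ V → Arrangement m (V ∖ v) w → Arrangement (suc m) V (v ∷ w)

length-arrangement : ∀ {m V w} → Arrangement m V w → length w ≡ m
length-arrangement []      = refl
length-arrangement (_ ∷ a) = cong suc (length-arrangement a)

countAbove-arrangement : ∀ b {m V w} → Arrangement m V w → DistinctAbs V → length V ≡ m →
                         countAbove b w ≡ countAbove b V
countAbove-arrangement b {V = []}    []  _  _  = refl
countAbove-arrangement b {V = _ ∷ _} []  _  ()
countAbove-arrangement b {suc m} {V} (_∷_ {v = v} v∈V a) V! |V|≡ = trans
  (cong (1 when (v >ᵇ b) ℕ.+_)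
        (countAbove-arrangement b a (distinctAbs-∖ v V!) (ℕₚ.suc-injective (trans (sym (length-∖ v∈V V!)) |V|≡))))
  (sym (countAbove-∖ b v∈V V!))

countAbove-∷ʳ-arrangement : ∀ b {c m U w} → c ∈ U → DistinctAbs U → Arrangement m (U ∖ c) w → length (U ∖ c) ≡ m →
                            countAbove b (w ∷ʳ c) ≡ countAbove b U
countAbove-∷ʳ-arrangement b {c} {U = U} {w} c∈U U! a |U∖c|≡ = begin
  countAbove b (w ∷ʳ c)                             ≡⟨ countAbove-++ b w (c ∷ []) ⟩
  countAbove b w ℕ.+ (1 when (c >ᵇ b) ℕ.+ 0)        ≡⟨ cong₂ ℕ._+_ (countAbove-arrangement b a (distinctAbs-∖ c U!) |U∖c|≡)
                                                                  (ℕₚ.+-identityʳ _) ⟩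
  countAbove b (U ∖ c) ℕ.+ 1 when (c >ᵇ b)          ≡⟨ ℕₚ.+-comm (countAbove b (U ∖ c)) _ ⟩
  1 when (c >ᵇ b) ℕ.+ countAbove b (U ∖ c)          ≡⟨ countAbove-∖ b c∈U U! ⟨
  countAbove b U                                    ∎
  where open ≡-Reasoning

-- Choosing a sign for each absolute value

plus minus : ℕ → ℤ
plus  k = ℤ.+ suc k
minus k = -[1+ k ]

-- alphabet n is definitionally signed (upTo n).
signed : List ℕ → List ℤ
signed M = map plus M ++ map minus M

signChoices : List ℕ → List (List ℤ)
signChoices []      = [] ∷ []
signChoices (j ∷ M) = map (plus j ∷_) (signChoices M) ++ map (minus j ∷_) (signChoices M)

infixl 6 _∖ℕ_

_∖ℕ_ : List ℕ → ℕ → List ℕ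
M ∖ℕ j = filterᵇ (λ k → not (k ≡ᵇ j)) M

signed-∖ : ∀ j M {v} → ∣ v ∣ ≡ suc j → signed M ∖ v ≡ signed (M ∖ℕ j)
signed-∖ j M ∣v∣≡ rewrite ∣v∣≡ = trans (Listₚ.filter-++ (T? ∘ _) (map plus M) (map minus M))
                          (cong₂ _++_ (filterᵇ-map _ plus M) (filterᵇ-map _ minus M))

∖ℕ-fresh : ∀ j M → All (j ≢_) M → M ∖ℕ j ≡ M
∖ℕ-fresh j []      []           = refl
∖ℕ-fresh j (k ∷ M) (j≢k ∷ j≢M) rewrite ≢⇒≡ᵇ-false (j≢k ∘ sym) = cong (k ∷_) (∖ℕ-fresh j M j≢M)

∷-∖ℕ-self : ∀ j M → (j ∷ M) ∖ℕ j ≡ M ∖ℕ j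
∷-∖ℕ-self j M rewrite ≡ᵇ-refl j = refl

∷-∖ℕ-other : ∀ {j k} M → k ≢ j → (k ∷ M) ∖ℕ j ≡ k ∷ M ∖ℕ j
∷-∖ℕ-other M k≢j rewrite ≢⇒≡ᵇ-false k≢j = refl

unique-∖ℕ : ∀ j {M} → Unique M → Unique (M ∖ℕ j)
unique-∖ℕ j = Uniqueₚ.filter⁺ _

length-∖ℕ : ∀ {j M} → j ∈ M → Unique M → length M ≡ suc (length (M ∖ℕ j))
length-∖ℕ {j} {j ∷ M} (here refl) (j≢M ∷ _) rewrite ≡ᵇ-refl j | ∖ℕ-fresh j M j≢M = refl
length-∖ℕ {j} {k ∷ M} (there j∈M) (k≢M ∷ M!) rewrite ≢⇒≡ᵇ-false (All.lookup k≢M j∈M) =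
  cong suc (length-∖ℕ j∈M M!)

signChoices-avoid : ∀ j M → All (j ≢_) M → All (All (λ v → ∣ v ∣ ≢ suc j)) (signChoices M)
signChoices-avoid j []      []          = [] ∷ []
signChoices-avoid j (k ∷ M) (j≢k ∷ j≢M) = Allₚ.++⁺ (Allₚ.map⁺ (All.map (k≢j ∷_) rest))
                                                  (Allₚ.map⁺ (All.map (k≢j ∷_) rest))
  where
  rest = signChoices-avoid j M j≢M
  k≢j : suc k ≢ suc j
  k≢j = j≢k ∘ sym ∘ ℕₚ.suc-injective

signChoices-distinctAbs : ∀ {M} → Unique M → All DistinctAbs (signChoices M)
signChoices-distinctAbs {[]}    []        = [] ∷ []
signChoices-distinctAbs {k ∷ M} (k≢M ∷ M!) = Allₚ.++⁺ (Allₚ.map⁺ (extend refl)) (Allₚ.map⁺ (extend refl))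
  where
  extend : ∀ {v} → ∣ v ∣ ≡ suc k → All (DistinctAbs ∘ (v ∷_)) (signChoices M)
  extend ∣v∣≡ = All.zipWith (λ (fresh , V!) → All.map (λ y≢ v≡y → y≢ (trans (sym v≡y) ∣v∣≡)) fresh ∷ V!)
                            (signChoices-avoid k M k≢M , signChoices-distinctAbs M!)

length-signChoices : ∀ M → All (λ V → length V ≡ length M) (signChoices M)
length-signChoices []      = refl ∷ []
length-signChoices (k ∷ M) = Allₚ.++⁺ (Allₚ.map⁺ extend) (Allₚ.map⁺ extend)
  where extend = All.map (cong suc) (length-signChoices M)

infix 4 _∈ᵇ_

_∈ᵇ_ : ℕ → List ℕ → Bool
k ∈ᵇ X = foldr (λ j b → (k ≡ᵇ j) ∨ b) false X

avoids : List ℕ → List ℤ → Bool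
avoids X []      = true
avoids X (a ∷ w) = not (∣ a ∣ ∈ᵇ X) ∧ avoids X w

isSignedPermAvoiding : List ℕ → List ℤ → Bool
isSignedPermAvoiding X w = isSignedPerm w ∧ avoids X w

avoiding : List ℕ → List ℤ → List ℤ
avoiding X = filterᵇ (λ a → not (∣ a ∣ ∈ᵇ X))

avoids-[] : ∀ w → avoids [] w ≡ true
avoids-[] []      = refl
avoids-[] (_ ∷ w) = avoids-[] w

avoids-∷ : ∀ k X w → avoids (k ∷ X) w ≡ not (k ∈ᵇ map ∣_∣ w) ∧ avoids X w
avoids-∷ k X []      = refl
avoids-∷ k X (b ∷ w) rewrite avoids-∷ k X w | ≡ᵇ-sym ∣ b ∣ k = shuffle (k ≡ᵇ ∣ b ∣) _ _ _
  where
  shuffle : ∀ p x y z → not (p ∨ x) ∧ (not y ∧ z) ≡ not (p ∨ y) ∧ (not x ∧ z)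
  shuffle true  _     _     _ = refl
  shuffle false true  true  _ = refl
  shuffle false true  false _ = refl
  shuffle false false true  _ = refl
  shuffle false false false _ = refl

isSignedPermAvoiding-∷ : ∀ X a w →
  isSignedPermAvoiding X (a ∷ w) ≡ not (∣ a ∣ ∈ᵇ X) ∧ isSignedPermAvoiding (∣ a ∣ ∷ X) w
isSignedPermAvoiding-∷ X a w rewrite avoids-∷ ∣ a ∣ X w =
  shuffle (∣ a ∣ ∈ᵇ map ∣_∣ w) (isSignedPerm w) (not (∣ a ∣ ∈ᵇ X)) (avoids X w)
  where
  shuffle : ∀ x d n z → (not x ∧ d) ∧ (n ∧ z) ≡ n ∧ (d ∧ (not x ∧ z))
  shuffle true  d     true  _ = sym (Boolₚ.∧-zeroʳ d)
  shuffle true  _     false _ = refl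
  shuffle false true  true  _ = refl
  shuffle false true  false _ = refl
  shuffle false false true  _ = refl
  shuffle false false false _ = refl

avoiding-∖ : ∀ a X A → avoiding X A ∖ a ≡ avoiding (∣ a ∣ ∷ X) A
avoiding-∖ a X A = trans (filterᵇ-filterᵇ _ _ A) (filterᵇ-cong (λ v → deMorgan (∣ v ∣ ≡ᵇ ∣ a ∣) _) A)
  where
  deMorgan : ∀ p x → not x ∧ not p ≡ not (p ∨ x)
  deMorgan true  true  = refl
  deMorgan true  false = refl
  deMorgan false x     = Boolₚ.∧-identityʳ (not x)

-- Computations in a commutative ring

module InCommutativeRing {c ℓ : Level} (R : CommutativeRing c ℓ) where

  open CommutativeRing R renaming (refl to ≈-refl; sym to ≈-sym; trans to ≈-trans)
  open InRing R
  open RingProperties ring using (-‿distribˡ-*; -‿distribʳ-*; -1*x≈-x)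
  open GroupProperties +-group using () renaming (∙-cancelʳ to +-cancelʳ; ⁻¹-involutive to -‿involutive)
  open CommutativeSemigroupProperties +-commutativeSemigroup
    using () renaming (interchange to +-interchange; x∙yz≈y∙xz to x+yz≈y+xz)
  open CommutativeSemigroupProperties *-commutativeSemigroup
    using () renaming (interchange to *-interchange; x∙yz≈y∙xz to x*yz≈y*xz)
  open import Relation.Binary.Reasoning.Setoid setoid

  ∑ : List A → (A → Carrier) → Carrier
  ∑ []       f = 0#
  ∑ (x ∷ xs) f = f x + ∑ xs f

  syntax ∑ L (λ x → e) = ∑[ x ← L ] e

  sumList-map : ∀ (L : List A) f → sumList (map f L) ≡ ∑ L f
  sumList-map []      f = refl
  sumList-map (x ∷ L) f = cong (f x +_) (sumList-map L f)

  ∑-cong∈ : ∀ (L : List A) {f g : A → Carrier} → (∀ x → x ∈ L → f x ≈ g x) → ∑ L f ≈ ∑ L g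
  ∑-cong∈ []      f≈g = ≈-refl
  ∑-cong∈ (x ∷ L) f≈g = +-cong (f≈g x (here refl)) (∑-cong∈ L (λ y y∈L → f≈g y (there y∈L)))

  ∑-cong : ∀ (L : List A) {f g : A → Carrier} → (∀ x → f x ≈ g x) → ∑ L f ≈ ∑ L g
  ∑-cong L f≈g = ∑-cong∈ L (λ x _ → f≈g x)

  ∑-0 : ∀ (L : List A) → ∑[ _ ← L ] 0# ≈ 0#
  ∑-0 []      = ≈-refl
  ∑-0 (x ∷ L) = ≈-trans (+-identityˡ _) (∑-0 L)

  ∑-+ : ∀ (L : List A) f g → ∑[ x ← L ] (f x + g x) ≈ ∑ L f + ∑ L g
  ∑-+ []      f g = ≈-sym (+-identityˡ 0#)
  ∑-+ (x ∷ L) f g = ≈-trans (+-congˡ (∑-+ L f g)) (+-interchange (f x) (g x) (∑ L f) (∑ L g))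

  ∑-*ˡ : ∀ (L : List A) k f → ∑[ x ← L ] (k * f x) ≈ k * ∑ L f
  ∑-*ˡ []      k f = ≈-sym (zeroʳ k)
  ∑-*ˡ (x ∷ L) k f = ≈-trans (+-congˡ (∑-*ˡ L k f)) (≈-sym (distribˡ k (f x) (∑ L f)))

  ∑-*ʳ : ∀ (L : List A) k f → ∑[ x ← L ] (f x * k) ≈ ∑ L f * k
  ∑-*ʳ L k f = ≈-trans (∑-cong L (λ x → *-comm (f x) k)) (≈-trans (∑-*ˡ L k f) (*-comm k _))

  ∑-++ : ∀ (L M : List A) f → ∑ (L ++ M) f ≈ ∑ L f + ∑ M f
  ∑-++ []      M f = ≈-sym (+-identityˡ _)
  ∑-++ (x ∷ L) M f = ≈-trans (+-congˡ (∑-++ L M f)) (≈-sym (+-assoc _ _ _))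

  ∑-map : ∀ (L : List A) (g : A → B′) f → ∑ (map g L) f ≡ ∑ L (f ∘ g)
  ∑-map []      g f = refl
  ∑-map (x ∷ L) g f = cong (f (g x) +_) (∑-map L g f)

  ∑-concatMap : ∀ (L : List A) (g : A → List B′) f → ∑ (concatMap g L) f ≈ ∑[ x ← L ] ∑ (g x) f
  ∑-concatMap []      g f = ≈-refl
  ∑-concatMap (x ∷ L) g f = ≈-trans (∑-++ (g x) (concatMap g L) f) (+-congˡ (∑-concatMap L g f))

  ∑-comm : ∀ (L : List A) (M : List B′) (f : A → B′ → Carrier) → ∑[ x ← L ] ∑[ y ← M ] f x y ≈ ∑[ y ← M ] ∑[ x ← L ] f x y
  ∑-comm []      M f = ≈-sym (∑-0 M)
  ∑-comm (x ∷ L) M f = ≈-trans (+-congˡ (∑-comm L M f)) (≈-sym (∑-+ M (f x) _))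

  infix 7 _onlyIf_

  _onlyIf_ : Carrier → Bool → Carrier
  v onlyIf b = if b then v else 0#

  onlyIf-cong : ∀ {u v} b → u ≈ v → u onlyIf b ≈ v onlyIf b
  onlyIf-cong true  u≈v = u≈v
  onlyIf-cong false _   = ≈-refl

  onlyIf-∧ : ∀ v a b → v onlyIf (a ∧ b) ≡ (v onlyIf b) onlyIf a
  onlyIf-∧ v true  b = refl
  onlyIf-∧ v false b = refl

  ∑-onlyIf : ∀ (L : List A) b f → ∑[ x ← L ] (f x onlyIf b) ≈ ∑ L f onlyIf b
  ∑-onlyIf L true  f = ≈-refl
  ∑-onlyIf L false f = ∑-0 L

  ∑-filter : ∀ {P : A → Set} (P? : Decidable P) L f → ∑ (filter P? L) f ≈ ∑[ x ← L ] (f x onlyIf does (P? x))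
  ∑-filter P? []      f = ≈-refl
  ∑-filter P? (x ∷ L) f with does (P? x)
  ... | true  = +-congˡ (∑-filter P? L f)
  ... | false = ≈-trans (∑-filter P? L f) (≈-sym (+-identityˡ _))

  module +-Solver = CommutativeMonoidSolver +-commutativeMonoid
  module *-Solver = CommutativeMonoidSolver *-commutativeMonoid

  pow-cong : ∀ k {a b} → a ≈ b → pow a k ≈ pow b k
  pow-cong zero    a≈b = ≈-refl
  pow-cong (suc k) a≈b = *-cong a≈b (pow-cong k a≈b)

  pow-+ : ∀ a m n → pow a (m ℕ.+ n) ≈ pow a m * pow a n
  pow-+ a zero    n = ≈-sym (*-identityˡ _)
  pow-+ a (suc m) n = ≈-trans (*-congˡ (pow-+ a m n)) (≈-sym (*-assoc a (pow a m) (pow a n)))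

  pow-1# : ∀ k → pow 1# k ≈ 1#
  pow-1# zero    = ≈-refl
  pow-1# (suc k) = ≈-trans (*-identityˡ _) (pow-1# k)

  pow-distrib-* : ∀ a b k → pow (a * b) k ≈ pow a k * pow b k
  pow-distrib-* a b zero    = ≈-sym (*-identityˡ 1#)
  pow-distrib-* a b (suc k) = ≈-trans (*-congˡ (pow-distrib-* a b k)) (*-interchange a b (pow a k) (pow b k))

  pow-* : ∀ a m n → pow a (m ℕ.* n) ≈ pow (pow a m) n
  pow-* a zero    n = ≈-sym (pow-1# n)
  pow-* a (suc m) n = begin
    pow a (n ℕ.+ m ℕ.* n)        ≈⟨ pow-+ a n (m ℕ.* n) ⟩
    pow a n * pow a (m ℕ.* n)    ≈⟨ *-congˡ (pow-* a m n) ⟩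
    pow a n * pow (pow a m) n    ≈⟨ pow-distrib-* a (pow a m) n ⟨
    pow (a * pow a m) n          ∎

  sgnPow-+ : ∀ m n → sgnPow (m ℕ.+ n) ≈ sgnPow m * sgnPow n
  sgnPow-+ zero    n = ≈-sym (*-identityˡ _)
  sgnPow-+ (suc m) n = ≈-trans (-‿cong (sgnPow-+ m n)) (-‿distribˡ-* (sgnPow m) (sgnPow n))

  sgnPow-+-self : ∀ k → sgnPow (k ℕ.+ k) ≈ 1#
  sgnPow-+-self k = ≈-trans (sgnPow-+ k k) (square k)
    where
    square : ∀ k → sgnPow k * sgnPow k ≈ 1#
    square zero    = *-identityˡ 1#
    square (suc k) = begin
      (- sgnPow k) * (- sgnPow k)   ≈⟨ -‿distribˡ-* _ _ ⟨
      - (sgnPow k * (- sgnPow k))   ≈⟨ -‿cong (-‿distribʳ-* _ _) ⟨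
      - (- (sgnPow k * sgnPow k))   ≈⟨ -‿involutive _ ⟩
      sgnPow k * sgnPow k           ≈⟨ square k ⟩
      1#                            ∎

  pow-sgnPow : ∀ m k → pow (sgnPow m) k ≈ sgnPow (m ℕ.* k)
  pow-sgnPow m zero    rewrite ℕₚ.*-zeroʳ m = ≈-refl
  pow-sgnPow m (suc k) rewrite ℕₚ.*-suc m k = ≈-trans (*-congˡ (pow-sgnPow m k)) (≈-sym (sgnPow-+ m (m ℕ.* k)))

  -- ((-1)^m)^(m+1) = 1 since m(m+1) is even.
  pow-sgnPow-*-suc : ∀ m y → pow (sgnPow m * y) (suc m) ≈ pow y (suc m)
  pow-sgnPow-*-suc m y with m*[1+m]-even m
  ... | k , m[m+1]≡k+k = begin
    pow (sgnPow m * y) (suc m)              ≈⟨ pow-distrib-* (sgnPow m) y (suc m) ⟩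
    pow (sgnPow m) (suc m) * pow y (suc m)  ≈⟨ *-congʳ (pow-sgnPow m (suc m)) ⟩
    sgnPow (m ℕ.* suc m) * pow y (suc m)    ≡⟨ cong (λ e → sgnPow e * pow y (suc m)) m[m+1]≡k+k ⟩
    sgnPow (k ℕ.+ k) * pow y (suc m)        ≈⟨ *-congʳ (sgnPow-+-self k) ⟩
    1# * pow y (suc m)                      ≈⟨ *-identityˡ _ ⟩
    pow y (suc m)                           ∎

  sgnPow-*-pow : ∀ k y → sgnPow k * pow y k ≈ pow (- y) k
  sgnPow-*-pow zero    y = *-identityˡ 1#
  sgnPow-*-pow (suc k) y = begin
    (- sgnPow k) * (y * pow y k)     ≈⟨ -‿distribˡ-* _ _ ⟨
    - (sgnPow k * (y * pow y k))     ≈⟨ -‿cong (x*yz≈y*xz (sgnPow k) y (pow y k)) ⟩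
    - (y * (sgnPow k * pow y k))     ≈⟨ -‿distribˡ-* _ _ ⟩
    (- y) * (sgnPow k * pow y k)     ≈⟨ *-congˡ (sgnPow-*-pow k y) ⟩
    (- y) * pow (- y) k              ∎

  sgnPow≈pow-1 : ∀ k → sgnPow k ≈ pow (- 1#) k
  sgnPow≈pow-1 zero    = ≈-refl
  sgnPow≈pow-1 (suc k) = ≈-trans (-‿cong (sgnPow≈pow-1 k)) (≈-sym (-1*x≈-x _))

  pow-when : ∀ a n b → pow a (n when b) ≈ (if b then pow a n else 1#)
  pow-when a n true  = ≈-refl
  pow-when a n false = ≈-refl

  ∑< : ℕ → (ℕ → Carrier) → Carrier
  ∑< zero    f = 0#
  ∑< (suc n) f = f 0 + ∑< n (f ∘ suc)

  syntax ∑< n (λ r → e) = ∑[ r < n ] e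

  ∑<-cong : ∀ n {f g : ℕ → Carrier} → (∀ r → f r ≈ g r) → ∑< n f ≈ ∑< n g
  ∑<-cong zero    f≈g = ≈-refl
  ∑<-cong (suc n) f≈g = +-cong (f≈g 0) (∑<-cong n (f≈g ∘ suc))

  ∑<-*ˡ : ∀ n k (f : ℕ → Carrier) → ∑[ r < n ] (k * f r) ≈ k * ∑< n f
  ∑<-*ˡ zero    k f = ≈-sym (zeroʳ k)
  ∑<-*ˡ (suc n) k f = ≈-trans (+-congˡ (∑<-*ˡ n k (f ∘ suc))) (≈-sym (distribˡ k _ _))

  ∑<-pow : ∀ n y → ∑< n (pow y) ≈ qint n y
  ∑<-pow zero    y = ≈-refl
  ∑<-pow (suc n) y = +-congˡ (≈-trans (∑<-*ˡ n y (pow y)) (*-congˡ (∑<-pow n y)))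

  qint-suc : ∀ n y → qint (suc n) y ≈ qint n y + pow y n
  qint-suc zero    y = ≈-trans (+-congˡ (zeroʳ y)) (≈-trans (+-identityʳ 1#) (≈-sym (+-identityˡ 1#)))
  qint-suc (suc n) y = begin
    1# + y * qint (suc n) y              ≈⟨ +-congˡ (*-congˡ (qint-suc n y)) ⟩
    1# + y * (qint n y + pow y n)        ≈⟨ +-congˡ (distribˡ y _ _) ⟩
    1# + (y * qint n y + y * pow y n)    ≈⟨ +-assoc _ _ _ ⟨
    (1# + y * qint n y) + y * pow y n    ∎

  punchIn : ℕ → ℕ → ℕ
  punchIn r₀ r = 1 when not (r <ᵇ r₀) ℕ.+ r

  ∑<-punchIn : ∀ n r₀ (f : ℕ → Carrier) → r₀ ℕ.≤ n → f r₀ + ∑[ r < n ] f (punchIn r₀ r) ≈ ∑< (suc n) f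
  ∑<-punchIn n       zero    f _          = ≈-refl
  ∑<-punchIn (suc n) (suc r₀) f (s≤s r₀≤n) = begin
    f (suc r₀) + (f 0 + ∑[ r < n ] f (punchIn (suc r₀) (suc r)))
      ≈⟨ +-congˡ (+-congˡ (∑<-cong n (λ r → reflexive (cong f (ℕₚ.+-suc (1 when not (r <ᵇ r₀)) r))))) ⟩
    f (suc r₀) + (f 0 + ∑[ r < n ] f (suc (punchIn r₀ r)))
      ≈⟨ x+yz≈y+xz _ _ _ ⟩
    f 0 + (f (suc r₀) + ∑[ r < n ] f (suc (punchIn r₀ r)))
      ≈⟨ +-congˡ (∑<-punchIn n r₀ (f ∘ suc) r₀≤n) ⟩
    f 0 + ∑< (suc n) (f ∘ suc) ∎

  ∑<-raise-threshold : ∀ n G (f : ℕ → Carrier) t → G ℕ.< n →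
    ∑[ r < n ] (f r * (if r <ᵇ suc G then t else 1#)) + f G ≈
    ∑[ r < n ] (f r * (if r <ᵇ G then t else 1#)) + f G * t
  ∑<-raise-threshold (suc n) zero    f t _ = begin
    (f 0 * t + S) + f 0          ≈⟨ solve 3 (λ a b c → (a ⊕ b) ⊕ c ⊜ (c ⊕ b) ⊕ a) ≈-refl (f 0 * t) S (f 0) ⟩
    (f 0 + S) + f 0 * t          ≈⟨ +-congʳ (+-congʳ (*-identityʳ (f 0))) ⟨
    (f 0 * 1# + S) + f 0 * t     ∎
    where
    open +-Solver
    S = ∑[ r < n ] (f (suc r) * 1#)
  ∑<-raise-threshold (suc n) (suc G) f t (s≤s G<n) = begin
    (f 0 * t + ∑[ r < n ] (f (suc r) * (if r <ᵇ suc G then t else 1#))) + f (suc G)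
      ≈⟨ +-assoc _ _ _ ⟩
    f 0 * t + (∑[ r < n ] (f (suc r) * (if r <ᵇ suc G then t else 1#)) + f (suc G))
      ≈⟨ +-congˡ (∑<-raise-threshold n G (f ∘ suc) t G<n) ⟩
    f 0 * t + (∑[ r < n ] (f (suc r) * (if r <ᵇ G then t else 1#)) + f (suc G) * t)
      ≈⟨ +-assoc _ _ _ ⟨
    (f 0 * t + ∑[ r < n ] (f (suc r) * (if r <ᵇ G then t else 1#))) + f (suc G) * t ∎

  -- Multiplying the first G terms of 1 + y + ⋯ + y^(n-1) by y^n rotates it
  -- into y^G + ⋯ + y^(G+n-1).
  ∑<-rotate-geometric : ∀ n G y t → G ℕ.≤ n → t ≈ pow y n →
    ∑[ r < n ] (pow y r * (if r <ᵇ G then t else 1#)) ≈ pow y G * qint n y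
  ∑<-rotate-geometric n zero    y t _ _ = begin
    ∑[ r < n ] (pow y r * 1#)  ≈⟨ ∑<-cong n (λ r → *-identityʳ (pow y r)) ⟩
    ∑< n (pow y)               ≈⟨ ∑<-pow n y ⟩
    qint n y                   ≈⟨ *-identityˡ _ ⟨
    1# * qint n y              ∎
  ∑<-rotate-geometric n (suc G) y t G<n t≈yⁿ = +-cancelʳ (pow y G) _ _ (begin
    ∑[ r < n ] (pow y r * (if r <ᵇ suc G then t else 1#)) + pow y G
      ≈⟨ ∑<-raise-threshold n G (pow y) t G<n ⟩
    ∑[ r < n ] (pow y r * (if r <ᵇ G then t else 1#)) + pow y G * t
      ≈⟨ +-congʳ (∑<-rotate-geometric n G y t (ℕₚ.<⇒≤ G<n) t≈yⁿ) ⟩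
    pow y G * qint n y + pow y G * t
      ≈⟨ distribˡ _ _ _ ⟨
    pow y G * (qint n y + t)
      ≈⟨ *-congˡ (+-congˡ t≈yⁿ) ⟩
    pow y G * (qint n y + pow y n)
      ≈⟨ *-congˡ (qint-suc n y) ⟨
    pow y G * (1# + y * qint n y)
      ≈⟨ distribˡ _ _ _ ⟩
    pow y G * 1# + pow y G * (y * qint n y)
      ≈⟨ +-cong (*-identityʳ _) (≈-trans (x*yz≈y*xz _ _ _) (≈-sym (*-assoc _ _ _))) ⟩
    pow y G + (y * pow y G) * qint n y
      ≈⟨ +-comm _ _ ⟩
    (y * pow y G) * qint n y + pow y G ∎)

  -- The ranks countAbove c U of the entries c of U are 0, …, |U| - 1.
  ∑-countAbove : ∀ U (φ : ℕ → Carrier) → DistinctAbs U → ∑[ c ← U ] φ (countAbove c U) ≈ ∑< (length U) φ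
  ∑-countAbove []      φ _           = ≈-refl
  ∑-countAbove (u ∷ U) φ (u≢U ∷ U!) = begin
    φ (countAbove u (u ∷ U)) + ∑[ c ← U ] φ (countAbove c (u ∷ U))
      ≡⟨ cong (λ b → φ (1 when b ℕ.+ countAbove u U) + ∑[ c ← U ] φ (countAbove c (u ∷ U))) (>ᵇ-irrefl u) ⟩
    φ (countAbove u U) + ∑[ c ← U ] φ (countAbove c (u ∷ U))
      ≈⟨ +-congˡ (∑-cong∈ U (λ c c∈U → reflexive (cong (λ b → φ (1 when b ℕ.+ countAbove c U))
                                                       (>ᵇ-countAbove c∈U (∣u∣≢∣v∣⇒u≢v (All.lookup u≢U c∈U)))))) ⟩
    φ (countAbove u U) + ∑[ c ← U ] φ (punchIn (countAbove u U) (countAbove c U))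
      ≈⟨ +-congˡ (∑-countAbove U (φ ∘ punchIn (countAbove u U)) U!) ⟩
    φ (countAbove u U) + ∑[ r < length U ] φ (punchIn (countAbove u U) r)
      ≈⟨ ∑<-punchIn (length U) (countAbove u U) φ (countAbove-≤-length u U) ⟩
    ∑< (suc (length U)) φ ∎

  ∑arr : ℕ → List ℤ → (List ℤ → Carrier) → Carrier
  ∑arr zero    U h = h []
  ∑arr (suc m) U h = ∑[ u ← U ] ∑arr m (U ∖ u) (h ∘ (u ∷_))

  ∑arr-cong : ∀ m V {h h′ : List ℤ → Carrier} → (∀ w → Arrangement m V w → h w ≈ h′ w) → ∑arr m V h ≈ ∑arr m V h′
  ∑arr-cong zero    V h≈h′ = h≈h′ [] []
  ∑arr-cong (suc m) V h≈h′ = ∑-cong∈ V (λ u u∈V → ∑arr-cong m (V ∖ u) (λ w a → h≈h′ (u ∷ w) (u∈V ∷ a)))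

  ∑arr-*ʳ : ∀ m V (h : List ℤ → Carrier) k → ∑arr m V (λ w → h w * k) ≈ ∑arr m V h * k
  ∑arr-*ʳ zero    V h k = ≈-refl
  ∑arr-*ʳ (suc m) V h k = ≈-trans (∑-cong V (λ u → ∑arr-*ʳ m (V ∖ u) (h ∘ (u ∷_)) k)) (∑-*ʳ V k _)

  ∑-∖ : ∀ V u (f : ℤ → Carrier) → ∑ (V ∖ u) f ≈ ∑[ v ← V ] (f v onlyIf not (∣ v ∣ ≡ᵇ ∣ u ∣))
  ∑-∖ V u = ∑-filter (λ v → T? (not (∣ v ∣ ≡ᵇ ∣ u ∣))) V

  ∑arr-∷ʳ : ∀ m V (h : List ℤ → Carrier) → ∑arr (suc m) V h ≈ ∑[ v ← V ] ∑arr m (V ∖ v) (λ w → h (w ∷ʳ v))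
  ∑arr-∷ʳ zero    V h = ≈-refl
  ∑arr-∷ʳ (suc m) V h = begin
    ∑[ u ← V ] ∑arr (suc m) (V ∖ u) (h ∘ (u ∷_))
      ≈⟨ ∑-cong V (λ u → ≈-trans (∑arr-∷ʳ m (V ∖ u) (h ∘ (u ∷_))) (∑-∖ V u _)) ⟩
    ∑[ u ← V ] ∑[ v ← V ] (∑arr m (V ∖ u ∖ v) (λ w → h (u ∷ w ∷ʳ v)) onlyIf not (∣ v ∣ ≡ᵇ ∣ u ∣))
      ≈⟨ ∑-comm V V _ ⟩
    ∑[ v ← V ] ∑[ u ← V ] (∑arr m (V ∖ u ∖ v) (λ w → h (u ∷ w ∷ʳ v)) onlyIf not (∣ v ∣ ≡ᵇ ∣ u ∣))
      ≈⟨ ∑-cong V (λ v → ∑-cong V (λ u → reflexive (cong₂ (λ b U → ∑arr m U (λ w → h (u ∷ w ∷ʳ v)) onlyIf not b)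
                                                           (≡ᵇ-sym ∣ v ∣ ∣ u ∣) (∖-comm u v V)))) ⟩
    ∑[ v ← V ] ∑[ u ← V ] (∑arr m (V ∖ v ∖ u) (λ w → h (u ∷ w ∷ʳ v)) onlyIf not (∣ u ∣ ≡ᵇ ∣ v ∣))
      ≈⟨ ∑-cong V (λ v → ∑-∖ V v _) ⟨
    ∑[ v ← V ] ∑arr (suc m) (V ∖ v) (λ w → h (w ∷ʳ v)) ∎

  -- X records the absolute values already used by a prefix of the window.
  ∑-words-avoiding : ∀ A m X (f : List ℤ → Carrier) →
    ∑[ w ← words m A ] (f w onlyIf isSignedPermAvoiding X w) ≈ ∑arr m (avoiding X A) f
  ∑-words-avoiding A zero    X f = +-identityʳ _
  ∑-words-avoiding A (suc m) X f = begin
    ∑[ w ← words (suc m) A ] (f w onlyIf isSignedPermAvoiding X w)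
      ≈⟨ ∑-concatMap A _ _ ⟩
    ∑[ a ← A ] ∑[ w ← map (a ∷_) (words m A) ] (f w onlyIf isSignedPermAvoiding X w)
      ≈⟨ ∑-cong A (λ a → reflexive (∑-map (words m A) (a ∷_) _)) ⟩
    ∑[ a ← A ] ∑[ w ← words m A ] (f (a ∷ w) onlyIf isSignedPermAvoiding X (a ∷ w))
      ≈⟨ ∑-cong A (λ a → ∑-cong (words m A) (λ w → reflexive (trans
           (cong (f (a ∷ w) onlyIf_) (isSignedPermAvoiding-∷ X a w))
           (onlyIf-∧ (f (a ∷ w)) (not (∣ a ∣ ∈ᵇ X)) (isSignedPermAvoiding (∣ a ∣ ∷ X) w))))) ⟩
    ∑[ a ← A ] ∑[ w ← words m A ] ((f (a ∷ w) onlyIf isSignedPermAvoiding (∣ a ∣ ∷ X) w) onlyIf not (∣ a ∣ ∈ᵇ X))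
      ≈⟨ ∑-cong A (λ a → ∑-onlyIf (words m A) (not (∣ a ∣ ∈ᵇ X)) _) ⟩
    ∑[ a ← A ] (∑[ w ← words m A ] (f (a ∷ w) onlyIf isSignedPermAvoiding (∣ a ∣ ∷ X) w) onlyIf not (∣ a ∣ ∈ᵇ X))
      ≈⟨ ∑-cong A (λ a → onlyIf-cong (not (∣ a ∣ ∈ᵇ X)) (∑-words-avoiding A m (∣ a ∣ ∷ X) (f ∘ (a ∷_)))) ⟩
    ∑[ a ← A ] (∑arr m (avoiding (∣ a ∣ ∷ X) A) (f ∘ (a ∷_)) onlyIf not (∣ a ∣ ∈ᵇ X))
      ≈⟨ ∑-cong A (λ a → reflexive (cong (λ U → ∑arr m U (f ∘ (a ∷_)) onlyIf not (∣ a ∣ ∈ᵇ X)) (sym (avoiding-∖ a X A)))) ⟩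
    ∑[ a ← A ] (∑arr m (avoiding X A ∖ a) (f ∘ (a ∷_)) onlyIf not (∣ a ∣ ∈ᵇ X))
      ≈⟨ ∑-filter (λ a → T? (not (∣ a ∣ ∈ᵇ X))) A _ ⟨
    ∑arr (suc m) (avoiding X A) f ∎

  ∑-B : ∀ n (f : List ℤ → Carrier) → ∑ (B n) f ≈ ∑arr n (signed (upTo n)) f
  ∑-B n f = begin
    ∑ (B n) f
      ≈⟨ ∑-filter (T? ∘ isSignedPerm) (words n (alphabet n)) f ⟩
    ∑[ w ← words n (alphabet n) ] (f w onlyIf isSignedPerm w)
      ≈⟨ ∑-cong (words n (alphabet n)) (λ w → reflexive (cong (f w onlyIf_) (sym (unconstrained w)))) ⟩
    ∑[ w ← words n (alphabet n) ] (f w onlyIf isSignedPermAvoiding [] w)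
      ≈⟨ ∑-words-avoiding (alphabet n) n [] f ⟩
    ∑arr n (avoiding [] (alphabet n)) f
      ≡⟨ cong (λ A → ∑arr n A f) (filterᵇ-true (alphabet n)) ⟩
    ∑arr n (signed (upTo n)) f ∎
    where
    unconstrained : ∀ w → isSignedPermAvoiding [] w ≡ isSignedPerm w
    unconstrained w rewrite avoids-[] w = Boolₚ.∧-identityʳ _

  ∑-signed : ∀ M (g : ℤ → Carrier) → ∑ (signed M) g ≈ ∑[ k ← M ] g (plus k) + ∑[ k ← M ] g (minus k)
  ∑-signed M g = ≈-trans (∑-++ (map plus M) (map minus M) g)
                         (+-cong (reflexive (∑-map M plus g)) (reflexive (∑-map M minus g)))

  ∑-signChoices-∷ : ∀ j M (Ψ : List ℤ → Carrier) →
    ∑ (signChoices (j ∷ M)) Ψ ≈ ∑[ V ← signChoices M ] Ψ (plus j ∷ V) + ∑[ V ← signChoices M ] Ψ (minus j ∷ V)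
  ∑-signChoices-∷ j M Ψ = ≈-trans (∑-++ (map (plus j ∷_) (signChoices M)) (map (minus j ∷_) (signChoices M)) Ψ)
    (+-cong (reflexive (∑-map (signChoices M) (plus j ∷_) Ψ)) (reflexive (∑-map (signChoices M) (minus j ∷_) Ψ)))

  -- Choosing signs for M and then one entry v amounts to choosing k = |v| - 1 ∈ M,
  -- the sign of v, and signs for the rest of M.
  ∑-signChoices-pick : ∀ M (G : ℤ → List ℤ → Carrier) → Unique M →
    ∑[ V ← signChoices M ] ∑[ v ← V ] G v (V ∖ v) ≈
    ∑[ k ← M ] ∑[ V ← signChoices (M ∖ℕ k) ] (G (plus k) V + G (minus k) V)
  ∑-signChoices-pick []      G _           = +-identityˡ 0#
  ∑-signChoices-pick (j ∷ M) G (j≢M ∷ M!) = begin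
    ∑[ V ← signChoices (j ∷ M) ] ∑[ v ← V ] G v (V ∖ v)
      ≈⟨ ∑-signChoices-∷ j M _ ⟩
    ∑[ V ← signChoices M ] pickFrom (plus j) V + ∑[ V ← signChoices M ] pickFrom (minus j) V
      ≈⟨ +-cong (∑-cong∈ (signChoices M) (λ V V∈ → pickFrom-∷ (plus j) V (All.lookup fresh V∈)))
                (∑-cong∈ (signChoices M) (λ V V∈ → pickFrom-∷ (minus j) V (All.lookup fresh V∈))) ⟩
    ∑[ V ← signChoices M ] (G (plus j) V + ∑[ v ← V ] G v (plus j ∷ V ∖ v))
      + ∑[ V ← signChoices M ] (G (minus j) V + ∑[ v ← V ] G v (minus j ∷ V ∖ v))
      ≈⟨ +-cong (∑-+ (signChoices M) _ _) (∑-+ (signChoices M) _ _) ⟩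
    (∑[ V ← signChoices M ] G (plus j) V + ∑[ V ← signChoices M ] ∑[ v ← V ] G v (plus j ∷ V ∖ v))
      + (∑[ V ← signChoices M ] G (minus j) V + ∑[ V ← signChoices M ] ∑[ v ← V ] G v (minus j ∷ V ∖ v))
      ≈⟨ +-cong (+-congˡ (∑-signChoices-pick M (λ v V → G v (plus j ∷ V)) M!))
                (+-congˡ (∑-signChoices-pick M (λ v V → G v (minus j ∷ V)) M!)) ⟩
    (∑[ V ← signChoices M ] G (plus j) V + ∑[ k ← M ] ∑[ V ← signChoices (M ∖ℕ k) ] Ψ k (plus j ∷ V))
      + (∑[ V ← signChoices M ] G (minus j) V + ∑[ k ← M ] ∑[ V ← signChoices (M ∖ℕ k) ] Ψ k (minus j ∷ V))
      ≈⟨ +-interchange _ _ _ _ ⟩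
    (∑[ V ← signChoices M ] G (plus j) V + ∑[ V ← signChoices M ] G (minus j) V)
      + (∑[ k ← M ] ∑[ V ← signChoices (M ∖ℕ k) ] Ψ k (plus j ∷ V)
         + ∑[ k ← M ] ∑[ V ← signChoices (M ∖ℕ k) ] Ψ k (minus j ∷ V))
      ≈⟨ +-cong (∑-+ (signChoices M) _ _) (∑-+ M _ _) ⟨
    ∑[ V ← signChoices M ] Ψ j V
      + ∑[ k ← M ] (∑[ V ← signChoices (M ∖ℕ k) ] Ψ k (plus j ∷ V) + ∑[ V ← signChoices (M ∖ℕ k) ] Ψ k (minus j ∷ V))
      ≈⟨ +-cong (reflexive (cong (λ L → ∑ (signChoices L) (Ψ j)) (sym (trans (∷-∖ℕ-self j M) (∖ℕ-fresh j M j≢M)))))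
                (∑-cong∈ M (λ k k∈M → ≈-trans (≈-sym (∑-signChoices-∷ j (M ∖ℕ k) (Ψ k)))
                   (reflexive (cong (λ L → ∑ (signChoices L) (Ψ k)) (sym (∷-∖ℕ-other M (All.lookup j≢M k∈M))))))) ⟩
    ∑[ V ← signChoices ((j ∷ M) ∖ℕ j) ] Ψ j V + ∑[ k ← M ] ∑[ V ← signChoices ((j ∷ M) ∖ℕ k) ] Ψ k V ∎
    where
    fresh = signChoices-avoid j M j≢M
    Ψ : ℕ → List ℤ → Carrier
    Ψ k V = G (plus k) V + G (minus k) V
    pickFrom : ℤ → List ℤ → Carrier
    pickFrom s V = ∑[ v ← s ∷ V ] G v ((s ∷ V) ∖ v)
    pickFrom-∷ : ∀ s V → All (λ v → ∣ v ∣ ≢ ∣ s ∣) V → pickFrom s V ≈ G s V + ∑[ v ← V ] G v (s ∷ V ∖ v)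
    pickFrom-∷ s V s∉V = +-cong (reflexive (cong (G s) (∷-∖-self s V s∉V)))
      (∑-cong∈ V (λ v v∈V → reflexive (cong (G v) (∷-∖-other {s} {v} V (All.lookup s∉V v∈V ∘ sym)))))

  ∑arr-signed : ∀ m M (h : List ℤ → Carrier) → Unique M → length M ≡ m →
    ∑arr m (signed M) h ≈ ∑[ V ← signChoices M ] ∑arr m V h
  ∑arr-signed zero    []      h _  _  = ≈-sym (+-identityʳ _)
  ∑arr-signed zero    (_ ∷ _) h _  ()
  ∑arr-signed (suc m) M       h M! |M|≡ = begin
    ∑[ a ← signed M ] ∑arr m (signed M ∖ a) (h ∘ (a ∷_))
      ≈⟨ ∑-signed M _ ⟩
    ∑[ j ← M ] ∑arr m (signed M ∖ plus j) (h ∘ (plus j ∷_)) + ∑[ j ← M ] ∑arr m (signed M ∖ minus j) (h ∘ (minus j ∷_))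
      ≈⟨ +-cong (∑-cong∈ M (λ j j∈M → ≈-trans (reflexive (cong (λ L → ∑arr m L (h ∘ (plus j ∷_))) (signed-∖ j M {plus j} refl)))
                                               (∑arr-signed m (M ∖ℕ j) _ (unique-∖ℕ j M!) (length-rest j∈M))))
                (∑-cong∈ M (λ j j∈M → ≈-trans (reflexive (cong (λ L → ∑arr m L (h ∘ (minus j ∷_))) (signed-∖ j M {minus j} refl)))
                                               (∑arr-signed m (M ∖ℕ j) _ (unique-∖ℕ j M!) (length-rest j∈M)))) ⟩
    ∑[ j ← M ] ∑[ V ← signChoices (M ∖ℕ j) ] ∑arr m V (h ∘ (plus j ∷_))
      + ∑[ j ← M ] ∑[ V ← signChoices (M ∖ℕ j) ] ∑arr m V (h ∘ (minus j ∷_))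
      ≈⟨ ∑-+ M _ _ ⟨
    ∑[ j ← M ] (∑[ V ← signChoices (M ∖ℕ j) ] ∑arr m V (h ∘ (plus j ∷_))
                + ∑[ V ← signChoices (M ∖ℕ j) ] ∑arr m V (h ∘ (minus j ∷_)))
      ≈⟨ ∑-cong M (λ j → ∑-+ (signChoices (M ∖ℕ j)) _ _) ⟨
    ∑[ j ← M ] ∑[ V ← signChoices (M ∖ℕ j) ] (∑arr m V (h ∘ (plus j ∷_)) + ∑arr m V (h ∘ (minus j ∷_)))
      ≈⟨ ∑-signChoices-pick M (λ v V → ∑arr m V (h ∘ (v ∷_))) M! ⟨
    ∑[ V ← signChoices M ] ∑[ v ← V ] ∑arr m (V ∖ v) (h ∘ (v ∷_)) ∎
    where
    length-rest : ∀ {j} → j ∈ M → length (M ∖ℕ j) ≡ m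
    length-rest j∈M = ℕₚ.suc-injective (trans (sym (length-∖ℕ j∈M M!)) |M|≡)

  ∏ : List ℕ → (ℕ → Carrier) → Carrier
  ∏ []      g = 1#
  ∏ (k ∷ M) g = g k * ∏ M g

  prodUpTo-cong : ∀ n {f g : ℕ → Carrier} → (∀ k → f k ≈ g k) → prodUpTo n f ≈ prodUpTo n g
  prodUpTo-cong zero    f≈g = ≈-refl
  prodUpTo-cong (suc n) f≈g = *-cong (prodUpTo-cong n f≈g) (f≈g n)

  prodUpTo-suc : ∀ n (h : ℕ → Carrier) → prodUpTo (suc n) h ≈ h 0 * prodUpTo n (h ∘ suc)
  prodUpTo-suc zero    h = *-comm 1# (h 0)
  prodUpTo-suc (suc n) h = ≈-trans (*-congʳ (prodUpTo-suc n h)) (*-assoc _ _ _)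

  ∏-applyUpTo : ∀ (f : ℕ → ℕ) n (g : ℕ → Carrier) → ∏ (List.applyUpTo f n) g ≈ prodUpTo n (g ∘ f)
  ∏-applyUpTo f zero    g = ≈-refl
  ∏-applyUpTo f (suc n) g = ≈-trans (*-congˡ (∏-applyUpTo (f ∘ suc) n g)) (≈-sym (prodUpTo-suc n (g ∘ f)))

  -- With y = (-1)^m x, the entries c of U above b contribute an extra x^(m+1) = y^(m+1).
  ∑-countAbove-rotated : ∀ x m U b → DistinctAbs (b ∷ U) → length U ≡ suc m → let y = sgnPow m * x in
    ∑[ c ← U ] (pow y (countAbove c U) * pow x (suc m when (c >ᵇ b))) ≈ pow y (countAbove b U) * qint (suc m) y
  ∑-countAbove-rotated x m U b (b∉U ∷ U!) |U|≡ = begin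
    ∑[ c ← U ] (pow y (countAbove c U) * pow x (suc m when (c >ᵇ b)))
      ≈⟨ ∑-cong∈ U (λ c c∈U → reflexive (cong (λ t → pow y (countAbove c U) * pow x (suc m when t)) (above⇔rank c∈U))) ⟩
    ∑[ c ← U ] φ (countAbove c U)
      ≈⟨ ∑-countAbove U φ U! ⟩
    ∑< (length U) φ
      ≡⟨ cong (λ n → ∑< n φ) |U|≡ ⟩
    ∑< (suc m) φ
      ≈⟨ ∑<-cong (suc m) (λ r → *-congˡ {pow y r} (pow-when x (suc m) (r <ᵇ G))) ⟩
    ∑[ r < suc m ] (pow y r * (if r <ᵇ G then pow x (suc m) else 1#))
      ≈⟨ ∑<-rotate-geometric (suc m) G y (pow x (suc m)) G≤ (≈-sym (pow-sgnPow-*-suc m x)) ⟩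
    pow y G * qint (suc m) y ∎
    where
    y = sgnPow m * x
    G = countAbove b U
    φ : ℕ → Carrier
    φ r = pow y r * pow x (suc m when (r <ᵇ G))
    G≤ : G ℕ.≤ suc m
    G≤ = subst (G ℕ.≤_) |U|≡ (countAbove-≤-length b U)
    above⇔rank : ∀ {c} → c ∈ U → (c >ᵇ b) ≡ (countAbove c U <ᵇ G)
    above⇔rank c∈U = trans (>ᵇ-asym (b≢c ∘ sym)) (trans (cong not (>ᵇ-countAbove c∈U b≢c)) (Boolₚ.not-involutive _))
      where b≢c = ∣u∣≢∣v∣⇒u≢v (All.lookup b∉U c∈U)

  module Weights (q : Carrier) where

    q² : Carrier
    q² = pow q 2

    weight : List ℤ → Carrier
    weight w = sign w * pow q (flagMajor w)

    negWeight : ℤ → Carrier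
    negWeight v = sgnPow (negSum (v ∷ [])) * pow q (neg (v ∷ []))

    negWeights : List ℤ → Carrier
    negWeights []      = 1#
    negWeights (v ∷ V) = negWeight v * negWeights V

    negWeights-++ : ∀ V₁ V₂ → negWeights (V₁ ++ V₂) ≈ negWeights V₁ * negWeights V₂
    negWeights-++ []       V₂ = ≈-sym (*-identityˡ _)
    negWeights-++ (v ∷ V₁) V₂ = ≈-trans (*-congˡ (negWeights-++ V₁ V₂)) (≈-sym (*-assoc _ _ _))

    negWeights-∖ : ∀ {v V} → v ∈ V → DistinctAbs V → negWeights V ≈ negWeight v * negWeights (V ∖ v)
    negWeights-∖ {v} v∈V V! with ∖-split v∈V V!
    ... | V₁ , V₂ , refl , V∖v≡ = begin
      negWeights (V₁ ++ v ∷ V₂)                     ≈⟨ negWeights-++ V₁ (v ∷ V₂) ⟩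
      negWeights V₁ * (negWeight v * negWeights V₂) ≈⟨ x*yz≈y*xz _ _ _ ⟩
      negWeight v * (negWeights V₁ * negWeights V₂) ≈⟨ *-congˡ (negWeights-++ V₁ V₂) ⟨
      negWeight v * negWeights (V₁ ++ V₂)           ≡⟨ cong (λ V → negWeight v * negWeights V) V∖v≡ ⟨
      negWeight v * negWeights ((V₁ ++ v ∷ V₂) ∖ v) ∎

    weight-∷ʳ : ∀ w c b → let J = suc (length w) when (c >ᵇ b) in
      weight (w ∷ʳ c ∷ʳ b) ≈ weight (w ∷ʳ c) * ((sgnPow (countAbove b (w ∷ʳ c)) * negWeight b) * pow q² J)
    weight-∷ʳ w c b = begin
      sgnPow (len (p ∷ʳ b)) * pow q (flagMajor (p ∷ʳ b))
        ≡⟨ cong₂ (λ l f → sgnPow l * pow q f) (len-∷ʳ p b) (flagMajor-∷ʳ w c b) ⟩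
      sgnPow (len p ℕ.+ (C ℕ.+ negSum (b ∷ []))) * pow q (flagMajor p ℕ.+ (2 ℕ.* J ℕ.+ neg (b ∷ [])))
        ≈⟨ *-cong (≈-trans (sgnPow-+ (len p) _) (*-congˡ (sgnPow-+ C _)))
                  (≈-trans (pow-+ q (flagMajor p) _) (*-congˡ (≈-trans (pow-+ q (2 ℕ.* J) _) (*-congʳ (pow-* q 2 J))))) ⟩
      (sgnPow (len p) * (sgnPow C * sgnPow (negSum (b ∷ [])))) * (pow q (flagMajor p) * (pow q² J * pow q (neg (b ∷ []))))
        ≈⟨ solve 6 (λ l c s f j n → (l ⊕ (c ⊕ s)) ⊕ (f ⊕ (j ⊕ n)) ⊜ (l ⊕ f) ⊕ ((c ⊕ (s ⊕ n)) ⊕ j)) ≈-refl _ _ _ _ _ _ ⟩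
      weight p * ((sgnPow C * negWeight b) * pow q² J) ∎
      where
      open *-Solver
      p = w ∷ʳ c
      C = countAbove b p
      J = suc (length w) when (c >ᵇ b)

    -- Appending b to w ∷ʳ c multiplies the weight by a factor that depends on w
    -- only through the set of its entries.
    ∑arr-weight-∷ʳ-∷ʳ : ∀ m U b → DistinctAbs U → length U ≡ suc m →
      ∑arr (suc m) U (λ w → weight (w ∷ʳ b)) ≈
      ∑[ c ← U ] (∑arr m (U ∖ c) (λ w → weight (w ∷ʳ c)) * ((sgnPow (countAbove b U) * negWeight b) * pow q² (suc m when (c >ᵇ b))))
    ∑arr-weight-∷ʳ-∷ʳ m U b U! |U|≡ = begin
      ∑arr (suc m) U (λ w → weight (w ∷ʳ b))
        ≈⟨ ∑arr-∷ʳ m U (λ w → weight (w ∷ʳ b)) ⟩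
      ∑[ c ← U ] ∑arr m (U ∖ c) (λ w → weight (w ∷ʳ c ∷ʳ b))
        ≈⟨ ∑-cong∈ U (λ c c∈U → ∑arr-cong m (U ∖ c) (λ w a → ≈-trans (weight-∷ʳ w c b) (*-congˡ (reflexive (factor-≡ c∈U a))))) ⟩
      ∑[ c ← U ] ∑arr m (U ∖ c) (λ w → weight (w ∷ʳ c) * K c)
        ≈⟨ ∑-cong U (λ c → ∑arr-*ʳ m (U ∖ c) _ (K c)) ⟩
      ∑[ c ← U ] (∑arr m (U ∖ c) (λ w → weight (w ∷ʳ c)) * K c) ∎
      where
      K : ℤ → Carrier
      K c = (sgnPow (countAbove b U) * negWeight b) * pow q² (suc m when (c >ᵇ b))
      length-rest : ∀ {c} → c ∈ U → length (U ∖ c) ≡ m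
      length-rest c∈U = ℕₚ.suc-injective (trans (sym (length-∖ c∈U U!)) |U|≡)
      factor-≡ : ∀ {c w} → c ∈ U → Arrangement m (U ∖ c) w →
        (sgnPow (countAbove b (w ∷ʳ c)) * negWeight b) * pow q² (suc (length w) when (c >ᵇ b)) ≡ K c
      factor-≡ {c} {w} c∈U a = cong₂ (λ C l → (sgnPow C * negWeight b) * pow q² (suc l when (c >ᵇ b)))
        (countAbove-∷ʳ-arrangement b c∈U U! a (length-rest c∈U)) (length-arrangement a)

    -- The signed Mahonian identity, refined by the last letter b of the window.
    ∑arr-weight-∷ʳ : ∀ m U b → DistinctAbs (b ∷ U) → length U ≡ m →
      ∑arr m U (λ w → weight (w ∷ʳ b)) ≈
      ((pow (sgnPow m * q²) (countAbove b U) * signedFact m q²) * negWeights U) * negWeight b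
    ∑arr-weight-∷ʳ zero    []      b _ _  = ≈-sym (≈-trans (*-congʳ (≈-trans (*-identityʳ _) (*-identityʳ _))) (*-identityˡ _))
    ∑arr-weight-∷ʳ zero    (_ ∷ _) b _ ()
    ∑arr-weight-∷ʳ (suc m) U       b (b∉U ∷ U!) |U|≡ = begin
      ∑arr (suc m) U (λ w → weight (w ∷ʳ b))
        ≈⟨ ∑arr-weight-∷ʳ-∷ʳ m U b U! |U|≡ ⟩
      ∑[ c ← U ] (∑arr m (U ∖ c) (λ w → weight (w ∷ʳ c)) * K c)
        ≈⟨ ∑-cong∈ U (λ c c∈U → ≈-trans (*-congʳ (∑arr-weight-∷ʳ m (U ∖ c) c (distinctAbs-∷∖ c U!) (length-rest c∈U)))
                                         (term c∈U)) ⟩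
      ∑[ c ← U ] (Cst * (pow y (countAbove c U) * pow q² (suc m when (c >ᵇ b))))
        ≈⟨ ∑-*ˡ U Cst _ ⟩
      Cst * ∑[ c ← U ] (pow y (countAbove c U) * pow q² (suc m when (c >ᵇ b)))
        ≈⟨ *-congˡ (∑-countAbove-rotated q² m U b (b∉U ∷ U!) |U|≡) ⟩
      Cst * (pow y G * qint (suc m) y)
        ≈⟨ solve 6 (λ f ρ s ρb p i → (((f ⊕ ρ) ⊕ s) ⊕ ρb) ⊕ (p ⊕ i) ⊜ (((s ⊕ p) ⊕ (f ⊕ i)) ⊕ ρ) ⊕ ρb) ≈-refl _ _ _ _ _ _ ⟩
      (((sgnPow G * pow y G) * (signedFact m q² * qint (suc m) y)) * negWeights U) * negWeight b
        ≈⟨ *-congʳ (*-congʳ (*-congʳ (≈-trans (sgnPow-*-pow G y) (pow-cong G (-‿distribˡ-* (sgnPow m) q²))))) ⟩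
      ((pow (sgnPow (suc m) * q²) G * signedFact (suc m) q²) * negWeights U) * negWeight b ∎
      where
      open *-Solver
      y = sgnPow m * q²
      G = countAbove b U
      K : ℤ → Carrier
      K c = (sgnPow G * negWeight b) * pow q² (suc m when (c >ᵇ b))
      Cst = ((signedFact m q² * negWeights U) * sgnPow G) * negWeight b
      length-rest : ∀ {c} → c ∈ U → length (U ∖ c) ≡ m
      length-rest c∈U = ℕₚ.suc-injective (trans (sym (length-∖ c∈U U!)) |U|≡)
      term : ∀ {c} → c ∈ U →
        (((pow y (countAbove c (U ∖ c)) * signedFact m q²) * negWeights (U ∖ c)) * negWeight c) * K c ≈
        Cst * (pow y (countAbove c U) * pow q² (suc m when (c >ᵇ b)))
      term {c} c∈U = begin
        (((pow y (countAbove c (U ∖ c)) * signedFact m q²) * negWeights (U ∖ c)) * negWeight c) * K c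
          ≈⟨ solve 7 (λ p f ρ ρc s ρb t → (((p ⊕ f) ⊕ ρ) ⊕ ρc) ⊕ ((s ⊕ ρb) ⊕ t) ⊜ (((f ⊕ (ρc ⊕ ρ)) ⊕ s) ⊕ ρb) ⊕ (p ⊕ t))
                   ≈-refl _ _ _ _ _ _ _ ⟩
        (((signedFact m q² * (negWeight c * negWeights (U ∖ c))) * sgnPow G) * negWeight b)
          * (pow y (countAbove c (U ∖ c)) * pow q² (suc m when (c >ᵇ b)))
          ≈⟨ *-cong (*-congʳ (*-congʳ (*-congˡ (≈-sym (negWeights-∖ c∈U U!)))))
                    (reflexive (cong (λ r → pow y r * pow q² (suc m when (c >ᵇ b))) (countAbove-∖-self c∈U U!))) ⟩
        Cst * (pow y (countAbove c U) * pow q² (suc m when (c >ᵇ b))) ∎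

    ∑arr-weight : ∀ n V → DistinctAbs V → length V ≡ n → ∑arr n V weight ≈ signedFact n q² * negWeights V
    ∑arr-weight zero    []      _  _    = ≈-refl
    ∑arr-weight zero    (_ ∷ _) _  ()
    ∑arr-weight (suc m) V       V! |V|≡ = begin
      ∑arr (suc m) V weight
        ≈⟨ ∑arr-∷ʳ m V weight ⟩
      ∑[ b ← V ] ∑arr m (V ∖ b) (λ w → weight (w ∷ʳ b))
        ≈⟨ ∑-cong∈ V (λ b b∈V → ≈-trans (∑arr-weight-∷ʳ m (V ∖ b) b (distinctAbs-∷∖ b V!) (length-rest b∈V))
                                         (collect b∈V)) ⟩
      ∑[ b ← V ] ((signedFact m q² * negWeights V) * pow y (countAbove b V))
        ≈⟨ ∑-*ˡ V _ _ ⟩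
      (signedFact m q² * negWeights V) * ∑[ b ← V ] pow y (countAbove b V)
        ≈⟨ *-congˡ (∑-countAbove V (pow y) V!) ⟩
      (signedFact m q² * negWeights V) * ∑< (length V) (pow y)
        ≡⟨ cong (λ n → (signedFact m q² * negWeights V) * ∑< n (pow y)) |V|≡ ⟩
      (signedFact m q² * negWeights V) * ∑< (suc m) (pow y)
        ≈⟨ *-congˡ (∑<-pow (suc m) y) ⟩
      (signedFact m q² * negWeights V) * qint (suc m) y
        ≈⟨ solve 3 (λ f ρ i → (f ⊕ ρ) ⊕ i ⊜ (f ⊕ i) ⊕ ρ) ≈-refl _ _ _ ⟩
      signedFact (suc m) q² * negWeights V ∎
      where
      open *-Solver
      y = sgnPow m * q²
      length-rest : ∀ {b} → b ∈ V → length (V ∖ b) ≡ m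
      length-rest b∈V = ℕₚ.suc-injective (trans (sym (length-∖ b∈V V!)) |V|≡)
      collect : ∀ {b} → b ∈ V →
        ((pow y (countAbove b (V ∖ b)) * signedFact m q²) * negWeights (V ∖ b)) * negWeight b ≈
        (signedFact m q² * negWeights V) * pow y (countAbove b V)
      collect {b} b∈V = begin
        ((pow y (countAbove b (V ∖ b)) * signedFact m q²) * negWeights (V ∖ b)) * negWeight b
          ≈⟨ solve 4 (λ p f ρ ρb → ((p ⊕ f) ⊕ ρ) ⊕ ρb ⊜ (f ⊕ (ρb ⊕ ρ)) ⊕ p) ≈-refl _ _ _ _ ⟩
        (signedFact m q² * (negWeight b * negWeights (V ∖ b))) * pow y (countAbove b (V ∖ b))
          ≈⟨ *-cong (*-congˡ (≈-sym (negWeights-∖ b∈V V!))) (reflexive (cong (pow y) (countAbove-∖-self b∈V V!))) ⟩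
        (signedFact m q² * negWeights V) * pow y (countAbove b V) ∎

    ∑-signChoices-weight : ∀ m M → Unique M → length M ≡ m →
      ∑[ V ← signChoices M ] ∑arr m V weight ≈ signedFact m q² * ∑ (signChoices M) negWeights
    ∑-signChoices-weight m M M! |M|≡ = ≈-trans
      (∑-cong∈ (signChoices M) (λ V V∈ → ∑arr-weight m V (All.lookup (signChoices-distinctAbs M!) V∈)
                                                         (trans (All.lookup (length-signChoices M) V∈) |M|≡)))
      (∑-*ˡ (signChoices M) _ negWeights)

    ∑-negWeights : ∀ M → ∑ (signChoices M) negWeights ≈ ∏ M (λ k → negWeight (plus k) + negWeight (minus k))
    ∑-negWeights []      = +-identityʳ 1#
    ∑-negWeights (j ∷ M) = begin
      ∑ (signChoices (j ∷ M)) negWeights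
        ≈⟨ ∑-signChoices-∷ j M negWeights ⟩
      ∑[ V ← signChoices M ] (negWeight (plus j) * negWeights V) + ∑[ V ← signChoices M ] (negWeight (minus j) * negWeights V)
        ≈⟨ +-cong (∑-*ˡ (signChoices M) _ negWeights) (∑-*ˡ (signChoices M) _ negWeights) ⟩
      negWeight (plus j) * ∑ (signChoices M) negWeights + negWeight (minus j) * ∑ (signChoices M) negWeights
        ≈⟨ distribʳ _ _ _ ⟨
      (negWeight (plus j) + negWeight (minus j)) * ∑ (signChoices M) negWeights
        ≈⟨ *-congˡ (∑-negWeights M) ⟩
      (negWeight (plus j) + negWeight (minus j)) * ∏ M (λ k → negWeight (plus k) + negWeight (minus k)) ∎

    negWeight-± : ∀ k → negWeight (plus k) + negWeight (minus k) ≈ 1# - q * pow (- 1#) k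
    negWeight-± k = begin
      1# * 1# + sgnPow (suc k ℕ.+ 0) * (q * 1#)
        ≡⟨ cong (λ e → 1# * 1# + sgnPow e * (q * 1#)) (ℕₚ.+-identityʳ (suc k)) ⟩
      1# * 1# + (- sgnPow k) * (q * 1#)
        ≈⟨ +-cong (*-identityˡ 1#) (*-congˡ (*-identityʳ q)) ⟩
      1# + (- sgnPow k) * q
        ≈⟨ +-congˡ (-‿distribˡ-* _ _) ⟨
      1# - sgnPow k * q
        ≈⟨ +-congˡ (-‿cong (≈-trans (*-comm _ _) (*-congˡ (sgnPow≈pow-1 k)))) ⟩
      1# - q * pow (- 1#) k ∎

    ∑-negWeights-upTo : ∀ n → ∑ (signChoices (upTo n)) negWeights ≈ qPoch q (- 1#) n
    ∑-negWeights-upTo n = begin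
      ∑ (signChoices (upTo n)) negWeights                                  ≈⟨ ∑-negWeights (upTo n) ⟩
      ∏ (upTo n) (λ k → negWeight (plus k) + negWeight (minus k))          ≈⟨ ∏-applyUpTo id n _ ⟩
      prodUpTo n (λ k → negWeight (plus k) + negWeight (minus k))          ≈⟨ prodUpTo-cong n negWeight-± ⟩
      qPoch q (- 1#) n                                                     ∎

mainTheorem2 : ∀ {c ℓ : Level} (R : CommutativeRing c ℓ) (n : ℕ) → n ≥ 1 →
    (q : CommutativeRing.Carrier R) →
    CommutativeRing._≈_ R (InRing.lhs R n q) (InRing.rhs R n q)
mainTheorem2 R n _ q = begin
  lhs n q                                                ≡⟨ sumList-map (B n) weight ⟩
  ∑ (B n) weight                                         ≈⟨ ∑-B n weight ⟩
  ∑arr n (signed (upTo n)) weight                        ≈⟨ ∑arr-signed n (upTo n) weight upTo! |upTo| ⟩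
  ∑[ V ← signChoices (upTo n) ] ∑arr n V weight          ≈⟨ ∑-signChoices-weight n (upTo n) upTo! |upTo| ⟩
  signedFact n q² * ∑ (signChoices (upTo n)) negWeights  ≈⟨ *-congˡ (∑-negWeights-upTo n) ⟩
  signedFact n q² * qPoch q (- 1#) n                     ≈⟨ *-comm _ _ ⟩
  rhs n q                                                ∎
  where
  open CommutativeRing R using (setoid; _*_; -_; 1#; *-congˡ; *-comm)
  open InRing R
  open InCommutativeRing R
  open Weights q
  open import Relation.Binary.Reasoning.Setoid setoid
  upTo! = Uniqueₚ.upTo⁺ n
  |upTo| = Listₚ.length-upTo n
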